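{- Let $m\ge 2$ and $t\ge 1$ be integers. Let $E^{I_2(m)}_{T,\ell'}(t)$ denote the expected absolute length $\ell'(r_1\cdots r_t)$ of a product of $t$ reflections $r_1,\dots,r_t$ chosen independently and uniformly at random from the set $T$ of reflections of the dihedral group $I_2(m)$. Then $E^{I_2(m)}_{T,\ell'}(t)=1$ if $t$ is odd and $E^{I_2(m)}_{T,\ell'}(t)=2-\frac{2}{m}$ if $t$ is even.
   Context: The dihedral group $I_2(m)$ is the Coxeter group with presentation $\langle s_1,s_2 \mid s_1^2=s_2^2=(s_1s_2)^m=\mathrm{id}\rangle$, with simple reflections $s_1,s_2$. The reflections are the elements conjugate to $s_1$ or $s_2$; $T$ denotes the set of reflections. The absolute length $\ell'(w)$ is the minimal number of reflections whose product is $w$. For a monoid $M$, a nonempty finite subset $R\subseteq M$ and a function $\varphi:M\to\{0,1,2,\dots\}$, $E^M_{R,\varphi}(t):=|R|^{ -t}\sum_{r_1,\dots,r_t\in R}\varphi(r_1\cdots r_t)$. -}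

module Defs where

open import Data.Bool using (Bool; true; false; _xor_)
open import Data.Nat using (ℕ; zero; suc; _+_; _∸_; _^_; _≤_; _%_; NonZero)
open import Data.Nat.DivMod using (m%n<n)
open import Data.Fin using (Fin; toℕ; fromℕ<)
import Data.Fin.Properties as FinP
open import Data.Bool.Properties using () renaming (_≟_ to _≟B_)
open import Data.Product using (Σ; _×_; _,_; ∃)
open import Data.Product.Properties using (≡-dec)
open import Data.Sum using (_⊎_)
open import Data.Nat.ListAction using (sum)
open import Data.List using (List; []; _∷_; map; concatMap; foldl; length; allFin; filter; cartesianProductWith)
open import Data.List.Relation.Unary.All using (All)
open import Data.List.Relation.Unary.Any using (any?)
open import Relation.Binary.PropositionalEquality using (_≡_)
open import Relation.Nullary using (Dec)
open import Relation.Nullary.Decidable using (_⊎-dec_)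
import Data.List
open import Data.Integer using (+_)
open import Data.Rational using (ℚ; _/_) renaming (0ℚ to zeroℚ)

module _ (m : ℕ) .{{_ : NonZero m}} where
  addF : Fin m → Fin m → Fin m
  addF k l = fromℕ< (m%n<n (toℕ k + toℕ l) m)

  negF : Fin m → Fin m
  negF k = fromℕ< (m%n<n (m ∸ toℕ k) m)

-- An element (b , k) stands for  s₁^b r^k  where
-- r = s₁ s₂ (rotation of order m) and b = true means s₁^1.
-- Multiplication uses  r^k s₁ = s₁ r^(-k).
module Dihedral (n : ℕ) where
  m : ℕ
  m = suc (suc n)

  I₂ : Set
  I₂ = Bool × Fin m

  _·_ : I₂ → I₂ → I₂
  (a , k) · (false , l) = (a , addF m k l)
  (a , k) · (true  , l) = (a xor true , addF m (negF m k) l)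

  e : I₂
  e = (false , Data.Fin.zero)

  inv : I₂ → I₂
  inv (false , k) = (false , negF m k)
  inv (true  , k) = (true , k)

  -- simple reflections: s₁ = (true , 0), s₂ = s₁ r = (true , 1)
  s₁ s₂ : I₂
  s₁ = (true , Data.Fin.zero)
  s₂ = (true , Data.Fin.suc Data.Fin.zero)

  _≟_ : (x y : I₂) → Dec (x ≡ y)
  _≟_ = ≡-dec _≟B_ FinP._≟_

  elements : List I₂
  elements = map (false ,_) (allFin m) Data.List.++ map (true ,_) (allFin m)

  IsReflection : I₂ → Set
  IsReflection w = Σ I₂ λ g → (w ≡ (g · s₁) · inv g) ⊎ (w ≡ (g · s₂) · inv g)

  conj : I₂ → I₂ → I₂
  conj g x = (g · x) · inv g

  T : List I₂
  T = filter (λ w → any? (λ g → (w ≟ conj g s₁) ⊎-dec (w ≟ conj g s₂)) elements) elements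

  prod : List I₂ → I₂
  prod = foldl _·_ e

  IsAbsLength : (I₂ → ℕ) → Set
  IsAbsLength φ = ∀ w →
    (Σ (List I₂) λ rs → All IsReflection rs × length rs ≡ φ w × prod rs ≡ w)
    × (∀ rs → All IsReflection rs → prod rs ≡ w → φ w ≤ length rs)

tuples : {A : Set} → List A → ℕ → List (List A)
tuples R zero    = [] ∷ []
tuples R (suc t) = concatMap (λ r → map (r ∷_) (tuples R t)) R

divℕ : ℕ → ℕ → ℚ
divℕ s zero    = zeroℚ   -- never used: R is nonempty
divℕ s (suc d) = (+ s) / suc d

E : {M : Set} → (M → M → M) → M → List M → (M → ℕ) → ℕ → ℚ
E _∙_ ε R φ t = divℕ (sum (map (λ rs → φ (foldl _∙_ ε rs)) (tuples R t))) (length R ^ t)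

-- Identify a reflection s₁ r^k with (true , k) and a rotation r^k with (false , k).  The m
-- reflections are exactly the elements (true , k), so ℓ′ is 1 on them, 0 on e and 2 on the
-- other rotations; multiplying by a reflection flips the Bool, so r₁ ⋯ r_t is a reflection
-- iff t is odd.  Hence for odd t every one of the m^t products has length 1, while for even t
-- the last factor r_t turns the reflection r₁ ⋯ r_{t-1} into e for exactly one of its m
-- choices and into a rotation of length 2 otherwise: the total is 2(m - 1)m^(t-1).

module Submission where

open import Defs
open import Algebra.Bundles using (Group)
open import Algebra.Structures using (IsGroup)
import Algebra.Properties.Group as GroupProperties
open import Data.Bool using (Bool; true; false; not; _xor_)
open import Data.Bool.Properties using (xor-identityʳ; xor-assoc; not-involutive)
open import Data.Empty using (⊥-elim)
open import Data.Fin as Fin using (Fin; toℕ; fromℕ<)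
import Data.Fin.Properties as Fin
open import Data.Integer as ℤ using (+_)
import Data.Integer.Properties as ℤ
open import Data.List using (List; []; _∷_; map; concatMap; tabulate; allFin; _++_; length; foldl; filter)
import Data.List.Properties as List
import Data.List.Relation.Unary.All as All
import Data.List.Relation.Unary.All.Properties as All
open import Data.List.Relation.Unary.Any using (any?)
import Data.List.Relation.Unary.Any as Any
open import Data.List.Membership.Propositional using (_∈_; lose)
open import Data.List.Membership.Propositional.Properties using (∈-allFin; ∈-map⁺; ∈-++⁺ˡ; ∈-++⁺ʳ)
open import Data.Nat using (ℕ; zero; suc; _+_; _*_; _∸_; _^_; _≤_; _<_; _%_; z≤n; s≤s)
open import Data.Nat.DivMod using (%-distribˡ-+; m%n%n≡m%n; m<n⇒m%n≡m; n%n≡0)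
open import Data.Nat.ListAction using (sum)
open import Data.Nat.ListAction.Properties using (sum-++)
import Data.Nat.Properties as ℕ
open import Data.Nat.Tactic.RingSolver using (solve-∀)
open import Data.Product using (∃-syntax; _×_; _,_; proj₁; proj₂; map₂)
open import Data.Rational using (_/_; _-_; -_; 1ℚ; toℚᵘ; fromℚᵘ)
open import Data.Rational.Properties using (fromℚᵘ-cong; fromℚᵘ-toℚᵘ; toℚᵘ-fromℚᵘ; toℚᵘ-homo-+; toℚᵘ-homo‿-)
open import Data.Rational.Unnormalised using (mkℚᵘ; *≡*) renaming (_≃_ to _≃ᵘ_)
import Data.Rational.Unnormalised as ℚᵘ
import Data.Rational.Unnormalised.Properties as ℚᵘ
open import Data.Sum using (_⊎_; inj₁; inj₂)
open import Function using (_∘_)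
open import Relation.Binary.PropositionalEquality
open import Relation.Binary.PropositionalEquality.Properties using (isEquivalence)
open import Relation.Nullary using (¬_)
open import Relation.Nullary.Decidable using (_⊎-dec_)

tupleSum : {A : Set} → (A → A → A) → (A → ℕ) → List A → A → ℕ → ℕ
tupleSum _∙_ f R g t = sum (map (λ rs → f (foldl _∙_ g rs)) (tuples R t))

sum-concatMap : {A : Set} (h : A → List ℕ) (xs : List A) →
  sum (concatMap h xs) ≡ sum (map (sum ∘ h) xs)
sum-concatMap h []       = refl
sum-concatMap h (x ∷ xs) = trans (sum-++ (h x) (concatMap h xs)) (cong (λ s → sum (h x) + s) (sum-concatMap h xs))

tupleSum-suc : {A : Set} (_∙_ : A → A → A) (f : A → ℕ) (R : List A) (g : A) (t : ℕ) →
  tupleSum _∙_ f R g (suc t) ≡ sum (map (λ r → tupleSum _∙_ f R (g ∙ r) t) R)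
tupleSum-suc _∙_ f R g t = begin
  sum (map F (concatMap (λ r → map (r ∷_) (tuples R t)) R))
    ≡⟨ cong sum (List.map-concatMap F (λ r → map (r ∷_) (tuples R t)) R) ⟩
  sum (concatMap (λ r → map F (map (r ∷_) (tuples R t))) R)
    ≡⟨ sum-concatMap _ R ⟩
  sum (map (λ r → sum (map F (map (r ∷_) (tuples R t)))) R)
    ≡⟨ cong sum (List.map-cong (λ r → cong sum (sym (List.map-∘ (tuples R t)))) R) ⟩
  sum (map (λ r → tupleSum _∙_ f R (g ∙ r) t) R) ∎
  where
  open ≡-Reasoning
  F : List _ → ℕ
  F rs = f (foldl _∙_ g rs)

sum-tabulate-const : ∀ {k} (f : Fin k → ℕ) c → (∀ i → f i ≡ c) → sum (tabulate f) ≡ k * c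
sum-tabulate-const {zero}  f c f≡c = refl
sum-tabulate-const {suc k} f c f≡c = cong₂ _+_ (f≡c Fin.zero) (sum-tabulate-const (f ∘ Fin.suc) c (f≡c ∘ Fin.suc))

sum-tabulate-const-except : ∀ {k} (f : Fin (suc k) → ℕ) i c → (∀ j → j ≢ i → f j ≡ c) →
  sum (tabulate f) ≡ f i + k * c
sum-tabulate-const-except f Fin.zero c f≡c =
  cong (λ s → f Fin.zero + s) (sum-tabulate-const (f ∘ Fin.suc) c (λ j → f≡c (Fin.suc j) λ ()))
sum-tabulate-const-except {suc k} f (Fin.suc i) c f≡c = begin
  f Fin.zero + sum (tabulate (f ∘ Fin.suc))
    ≡⟨ cong₂ _+_ (f≡c Fin.zero λ ()) (sum-tabulate-const-except (f ∘ Fin.suc) i c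
                    (λ j j≢i → f≡c (Fin.suc j) (j≢i ∘ Fin.suc-injective))) ⟩
  c + (f (Fin.suc i) + k * c)
    ≡⟨ left-comm c (f (Fin.suc i)) (k * c) ⟩
  f (Fin.suc i) + suc k * c ∎
  where
  open ≡-Reasoning
  left-comm : ∀ x y z → x + (y + z) ≡ y + (x + z)
  left-comm = solve-∀

isOdd : ℕ → Bool
isOdd zero    = false
isOdd (suc t) = not (isOdd t)

%2≡1⇒isOdd≡true : ∀ t → t % 2 ≡ 1 → isOdd t ≡ true
%2≡1⇒isOdd≡true (suc zero)    _ = refl
%2≡1⇒isOdd≡true (suc (suc t)) h = trans (not-involutive (isOdd t)) (%2≡1⇒isOdd≡true t h)

%2≡0⇒isOdd≡false : ∀ t → t % 2 ≡ 0 → isOdd t ≡ false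
%2≡0⇒isOdd≡false zero          _ = refl
%2≡0⇒isOdd≡false (suc (suc t)) h = trans (not-involutive (isOdd t)) (%2≡0⇒isOdd≡false t h)

fromℚᵘ-homo-- : ∀ x y → fromℚᵘ (x ℚᵘ.- y) ≡ fromℚᵘ x - fromℚᵘ y
fromℚᵘ-homo-- x y = trans (fromℚᵘ-cong x-y≃) (fromℚᵘ-toℚᵘ (fromℚᵘ x - fromℚᵘ y))
  where
  open ℚᵘ.≃-Reasoning
  x-y≃ : x ℚᵘ.- y ≃ᵘ toℚᵘ (fromℚᵘ x - fromℚᵘ y)
  x-y≃ = begin
    x ℚᵘ.- y                                   ≈⟨ ℚᵘ.+-cong (ℚᵘ.≃-sym (toℚᵘ-fromℚᵘ x)) (ℚᵘ.-‿cong (ℚᵘ.≃-sym (toℚᵘ-fromℚᵘ y))) ⟩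
    toℚᵘ (fromℚᵘ x) ℚᵘ.- toℚᵘ (fromℚᵘ y)       ≈⟨ ℚᵘ.+-congʳ (toℚᵘ (fromℚᵘ x)) (ℚᵘ.≃-sym (toℚᵘ-homo‿- (fromℚᵘ y))) ⟩
    toℚᵘ (fromℚᵘ x) ℚᵘ.+ toℚᵘ (- fromℚᵘ y)     ≈⟨ ℚᵘ.≃-sym (toℚᵘ-homo-+ (fromℚᵘ x) (- fromℚᵘ y)) ⟩
    toℚᵘ (fromℚᵘ x - fromℚᵘ y)                 ∎

divℕ-self : ∀ D → 0 < D → divℕ D D ≡ 1ℚ
divℕ-self (suc d) _ = fromℚᵘ-cong {mkℚᵘ (+ suc d) d} {mkℚᵘ (+ 1) 0}
  (*≡* (trans (ℤ.*-identityʳ (+ suc d)) (sym (ℤ.*-identityˡ (+ suc d)))))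

divℕ-2[m∸1]P-mP : ∀ k P → 0 < P → divℕ (suc k * 2 * P) (suc (suc k) * P) ≡ (+ 2 / 1) - (+ 2 / suc (suc k))
divℕ-2[m∸1]P-mP k (suc p) _ = trans (fromℚᵘ-cong cross) (fromℚᵘ-homo-- (mkℚᵘ (+ 2) 0) (mkℚᵘ (+ 2) (suc k)))
  where
  cross-ℕ : ∀ k p → suc k * 2 * suc p * (1 * suc (suc k)) ≡ (k + 1 * suc (suc k)) * suc (p + suc k * suc p)
  cross-ℕ = solve-∀
  cross : mkℚᵘ (+ (suc k * 2 * suc p)) (p + suc k * suc p) ≃ᵘ mkℚᵘ (+ 2) 0 ℚᵘ.- mkℚᵘ (+ 2) (suc k)
  cross = *≡* (trans (sym (ℤ.pos-* (suc k * 2 * suc p) (1 * suc (suc k))))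
                (trans (cong +_ (cross-ℕ k p)) (ℤ.pos-* (k + 1 * suc (suc k)) (suc (p + suc k * suc p)))))

module Cyclic (k : ℕ) where

  infixl 6 _⊕_
  _⊕_ : Fin (suc k) → Fin (suc k) → Fin (suc k)
  _⊕_ = addF (suc k)

  ⊖_ : Fin (suc k) → Fin (suc k)
  ⊖_ = negF (suc k)

  [m%n+o]%n≡[m+o]%n : ∀ x y → (x % suc k + y) % suc k ≡ (x + y) % suc k
  [m%n+o]%n≡[m+o]%n x y = begin
    (x % suc k + y) % suc k                  ≡⟨ %-distribˡ-+ (x % suc k) y (suc k) ⟩
    (x % suc k % suc k + y % suc k) % suc k  ≡⟨ cong (λ z → (z + y % suc k) % suc k) (m%n%n≡m%n x (suc k)) ⟩
    (x % suc k + y % suc k) % suc k          ≡⟨ %-distribˡ-+ x y (suc k) ⟨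
    (x + y) % suc k                          ∎
    where open ≡-Reasoning

  toℕ-⊕ : ∀ a b → toℕ (a ⊕ b) ≡ (toℕ a + toℕ b) % suc k
  toℕ-⊕ a b = Fin.toℕ-fromℕ< _

  toℕ-⊖ : ∀ a → toℕ (⊖ a) ≡ (suc k ∸ toℕ a) % suc k
  toℕ-⊖ a = Fin.toℕ-fromℕ< _

  toℕ%n≡toℕ : ∀ a → toℕ a % suc k ≡ toℕ a
  toℕ%n≡toℕ a = m<n⇒m%n≡m (Fin.toℕ<n a)

  toℕ-⊕-⊕ : ∀ a b c → toℕ (a ⊕ b ⊕ c) ≡ (toℕ a + toℕ b + toℕ c) % suc k
  toℕ-⊕-⊕ a b c = trans (toℕ-⊕ (a ⊕ b) c)
    (trans (cong (λ x → (x + toℕ c) % suc k) (toℕ-⊕ a b)) ([m%n+o]%n≡[m+o]%n (toℕ a + toℕ b) (toℕ c)))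

  ⊕-comm : ∀ a b → a ⊕ b ≡ b ⊕ a
  ⊕-comm a b = Fin.toℕ-injective
    (trans (toℕ-⊕ a b) (trans (cong (_% suc k) (ℕ.+-comm (toℕ a) (toℕ b))) (sym (toℕ-⊕ b a))))

  ⊕-assoc : ∀ a b c → a ⊕ b ⊕ c ≡ a ⊕ (b ⊕ c)
  ⊕-assoc a b c = Fin.toℕ-injective (begin
    toℕ (a ⊕ b ⊕ c)                    ≡⟨ toℕ-⊕-⊕ a b c ⟩
    (toℕ a + toℕ b + toℕ c) % suc k    ≡⟨ cong (_% suc k) (rotate (toℕ a) (toℕ b) (toℕ c)) ⟩
    (toℕ b + toℕ c + toℕ a) % suc k    ≡⟨ toℕ-⊕-⊕ b c a ⟨
    toℕ (b ⊕ c ⊕ a)                    ≡⟨ cong toℕ (⊕-comm (b ⊕ c) a) ⟩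
    toℕ (a ⊕ (b ⊕ c))                  ∎)
    where
    open ≡-Reasoning
    rotate : ∀ x y z → x + y + z ≡ y + z + x
    rotate = solve-∀

  ⊕-identityˡ : ∀ a → Fin.zero ⊕ a ≡ a
  ⊕-identityˡ a = Fin.toℕ-injective (trans (toℕ-⊕ Fin.zero a) (toℕ%n≡toℕ a))

  ⊕-inverseˡ : ∀ a → ⊖ a ⊕ a ≡ Fin.zero
  ⊕-inverseˡ a = Fin.toℕ-injective (begin
    toℕ (⊖ a ⊕ a)                          ≡⟨ toℕ-⊕ (⊖ a) a ⟩
    (toℕ (⊖ a) + toℕ a) % suc k            ≡⟨ cong (λ x → (x + toℕ a) % suc k) (toℕ-⊖ a) ⟩
    ((suc k ∸ toℕ a) % suc k + toℕ a) % suc k ≡⟨ [m%n+o]%n≡[m+o]%n (suc k ∸ toℕ a) (toℕ a) ⟩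
    (suc k ∸ toℕ a + toℕ a) % suc k        ≡⟨ cong (_% suc k) (ℕ.m∸n+n≡m (ℕ.<⇒≤ (Fin.toℕ<n a))) ⟩
    suc k % suc k                          ≡⟨ n%n≡0 (suc k) ⟩
    0                                      ∎)
    where open ≡-Reasoning

  ⊕-⊖-isGroup : IsGroup _≡_ _⊕_ Fin.zero ⊖_
  ⊕-⊖-isGroup = record
    { isMonoid = record
      { isSemigroup = record
        { isMagma = record { isEquivalence = isEquivalence ; ∙-cong = cong₂ _⊕_ }
        ; assoc = ⊕-assoc
        }
      ; identity = ⊕-identityˡ , λ a → trans (⊕-comm a Fin.zero) (⊕-identityˡ a)
      }
    ; inverse = ⊕-inverseˡ , λ a → trans (⊕-comm a (⊖ a)) (⊕-inverseˡ a)
    ; ⁻¹-cong = cong ⊖_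
    }

  ⊕-⊖-group : Group _ _
  ⊕-⊖-group = record { isGroup = ⊕-⊖-isGroup }

  open GroupProperties ⊕-⊖-group public using (ε⁻¹≈ε; ⁻¹-involutive; inverseʳ-unique)

-- Stated in the shape q + toℕ β + q of conj-rotation-toℕ, with β = s₁, s₂.
halve : ∀ x → ∃[ q ] (x ≡ q + 0 + q ⊎ x ≡ q + 1 + q)
halve zero          = 0 , inj₁ refl
halve (suc zero)    = 0 , inj₂ refl
halve (suc (suc x)) with halve x
... | q , inj₁ x≡2q   = suc q , inj₁ (cong suc (trans (cong suc x≡2q) (sym (ℕ.+-suc (q + 0) q))))
... | q , inj₂ x≡2q+1 = suc q , inj₂ (cong suc (trans (cong suc x≡2q+1) (sym (ℕ.+-suc (q + 1) q))))

module DihedralFacts (n : ℕ) where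
  open Dihedral n
  open Cyclic (suc n)

  proj₁-· : ∀ x y → proj₁ (x · y) ≡ proj₁ x xor proj₁ y
  proj₁-· (a , k) (false , l) = sym (xor-identityʳ a)
  proj₁-· (a , k) (true  , l) = refl

  ·-identityˡ : ∀ x → e · x ≡ x
  ·-identityˡ (false , l) = cong (false ,_) (⊕-identityˡ l)
  ·-identityˡ (true  , l) = trans (cong (λ z → true , z ⊕ l) ε⁻¹≈ε) (cong (true ,_) (⊕-identityˡ l))

  proj₁-conj : ∀ g l → proj₁ (conj g (true , l)) ≡ true
  proj₁-conj (false , _) l = refl
  proj₁-conj (true  , _) l = refl

  isReflection⇒proj₁≡true : ∀ {w} → IsReflection w → proj₁ w ≡ true
  isReflection⇒proj₁≡true (g , inj₁ w≡gs₁g⁻¹) = trans (cong proj₁ w≡gs₁g⁻¹) (proj₁-conj g Fin.zero)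
  isReflection⇒proj₁≡true (g , inj₂ w≡gs₂g⁻¹) = trans (cong proj₁ w≡gs₂g⁻¹) (proj₁-conj g (Fin.suc Fin.zero))

  conj-rotation : ∀ j β → conj (false , ⊖ j) (true , β) ≡ (true , j ⊕ β ⊕ j)
  conj-rotation j β = cong (λ i → true , i ⊕ β ⊕ i) (⁻¹-involutive j)

  -- The conjugate of s₁ r^β by r^(-q) is s₁ r^(2q + β).
  conj-rotation-toℕ : ∀ k β q → toℕ k ≡ q + toℕ β + q → ∃[ g ] (true , k) ≡ conj g (true , β)
  conj-rotation-toℕ k β q k≡2q+β =
    (false , ⊖ j) , trans (cong (true ,_) (Fin.toℕ-injective toℕ-k)) (sym (conj-rotation j β))
    where
    q<m : q < m
    q<m = ℕ.≤-<-trans (ℕ.≤-trans (ℕ.m≤m+n q (toℕ β)) (ℕ.m≤m+n (q + toℕ β) q))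
                      (subst (_< m) k≡2q+β (Fin.toℕ<n k))
    j : Fin m
    j = fromℕ< q<m
    toℕ-k : toℕ k ≡ toℕ (j ⊕ β ⊕ j)
    toℕ-k = begin
      toℕ k                         ≡⟨ toℕ%n≡toℕ k ⟨
      toℕ k % m                     ≡⟨ cong (_% m) k≡2q+β ⟩
      (q + toℕ β + q) % m           ≡⟨ cong (λ i → (i + toℕ β + i) % m) (Fin.toℕ-fromℕ< q<m) ⟨
      (toℕ j + toℕ β + toℕ j) % m   ≡⟨ toℕ-⊕-⊕ j β j ⟨
      toℕ (j ⊕ β ⊕ j)               ∎
      where open ≡-Reasoning

  true-isReflection : ∀ k → IsReflection (true , k)
  true-isReflection k with halve (toℕ k)
  ... | q , inj₁ k≡2q   = map₂ inj₁ (conj-rotation-toℕ k Fin.zero q k≡2q)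
  ... | q , inj₂ k≡2q+1 = map₂ inj₂ (conj-rotation-toℕ k (Fin.suc Fin.zero) q k≡2q+1)

  ∈-elements : ∀ g → g ∈ elements
  ∈-elements (false , j) = ∈-++⁺ˡ (∈-map⁺ (false ,_) (∈-allFin j))
  ∈-elements (true  , j) = ∈-++⁺ʳ (map (false ,_) (allFin m)) (∈-map⁺ (true ,_) (∈-allFin j))

  T≡reflections : T ≡ map (true ,_) (allFin m)
  T≡reflections = begin
    filter P? (map (false ,_) (allFin m) ++ map (true ,_) (allFin m))
      ≡⟨ List.filter-++ P? (map (false ,_) (allFin m)) (map (true ,_) (allFin m)) ⟩
    filter P? (map (false ,_) (allFin m)) ++ filter P? (map (true ,_) (allFin m))
      ≡⟨ cong₂ _++_ (List.filter-none P? (All.map⁺ (All.universal rotation-∉ (allFin m))))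
                    (List.filter-all P? (All.map⁺ (All.universal reflection-∈ (allFin m)))) ⟩
    map (true ,_) (allFin m) ∎
    where
    open ≡-Reasoning
    P? = λ w → any? (λ g → (w ≟ conj g s₁) ⊎-dec (w ≟ conj g s₂)) elements
    rotation-∉ : ∀ k → ¬ Any.Any (λ g → ((false , k) ≡ conj g s₁) ⊎ ((false , k) ≡ conj g s₂)) elements
    rotation-∉ k rotation-∈ with () ← isReflection⇒proj₁≡true (Any.satisfied rotation-∈)
    reflection-∈ : ∀ k → Any.Any (λ g → ((true , k) ≡ conj g s₁) ⊎ ((true , k) ≡ conj g s₂)) elements
    reflection-∈ k = lose (∈-elements _) (proj₂ (true-isReflection k))

  sum-map-T : ∀ f → sum (map f T) ≡ sum (tabulate (λ l → f (true , l)))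
  sum-map-T f = cong sum (begin
    map f T                              ≡⟨ cong (map f) T≡reflections ⟩
    map f (map (true ,_) (allFin m))     ≡⟨ List.map-∘ (allFin m) ⟨
    map (λ l → f (true , l)) (allFin m)  ≡⟨ List.map-tabulate (λ l → l) (λ l → f (true , l)) ⟩
    tabulate (λ l → f (true , l))        ∎)
    where open ≡-Reasoning

  length-T : length T ≡ m
  length-T = trans (cong length T≡reflections)
    (trans (List.length-map {B = I₂} (true ,_) (allFin m)) (List.length-tabulate {n = m} (λ l → l)))

  module AbsoluteLength (φ : I₂ → ℕ) (φ-abs : IsAbsLength φ) where

    φ-e : φ e ≡ 0
    φ-e = ℕ.n≤0⇒n≡0 (proj₂ (φ-abs e) [] All.[] refl)

    φ-reflection : ∀ k → φ (true , k) ≡ 1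
    φ-reflection k = ℕ.≤-antisym φ≤1 1≤φ
      where
      φ≤1 : φ (true , k) ≤ 1
      φ≤1 = proj₂ (φ-abs (true , k)) ((true , k) ∷ []) (true-isReflection k All.∷ All.[]) (·-identityˡ (true , k))
      1≤φ : 1 ≤ φ (true , k)
      1≤φ with proj₁ (φ-abs (true , k))
      ... | []    , _ , _   , e≡w with () ← cong proj₁ e≡w
      ... | _ ∷ _ , _ , len , _   = subst (1 ≤_) len (s≤s z≤n)

    φ-rotation : ∀ k → k ≢ Fin.zero → φ (false , k) ≡ 2
    φ-rotation k k≢0 = ℕ.≤-antisym φ≤2 2≤φ
      where
      s₁s₁r^k≡r^k : prod (s₁ ∷ (true , k) ∷ []) ≡ (false , k)
      s₁s₁r^k≡r^k = begin
        (e · s₁) · (true , k)    ≡⟨ cong (_· (true , k)) (·-identityˡ s₁) ⟩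
        (false , ⊖ Fin.zero ⊕ k) ≡⟨ cong (λ i → false , i ⊕ k) ε⁻¹≈ε ⟩
        (false , Fin.zero ⊕ k)   ≡⟨ cong (false ,_) (⊕-identityˡ k) ⟩
        (false , k)              ∎
        where open ≡-Reasoning
      φ≤2 : φ (false , k) ≤ 2
      φ≤2 = proj₂ (φ-abs (false , k)) _ (true-isReflection Fin.zero All.∷ true-isReflection k All.∷ All.[]) s₁s₁r^k≡r^k
      2≤φ : 2 ≤ φ (false , k)
      2≤φ with proj₁ (φ-abs (false , k))
      ... | []         , _                , _   , e≡w = ⊥-elim (k≢0 (sym (cong proj₂ e≡w)))
      ... | r ∷ []     , r-refl All.∷ _   , _   , er≡w
          with () ← trans (sym (isReflection⇒proj₁≡true r-refl)) (trans (sym (proj₁-· e r)) (cong proj₁ er≡w))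
      ... | _ ∷ _ ∷ _  , _                , len , _   = subst (2 ≤_) len (s≤s (s≤s z≤n))

    -- weight b is Σ_{r ∈ T} φ (g · r) when the products g · r are reflections (b = true) or
    -- rotations (b = false); in the latter case exactly one of them is e.
    weight : Bool → ℕ
    weight true  = m
    weight false = suc n * 2

    sum-φ-·-reflections : ∀ g → sum (tabulate (λ l → φ (g · (true , l)))) ≡ weight (proj₁ g xor true)
    sum-φ-·-reflections (false , c) =
      trans (sum-tabulate-const (λ l → φ (true , ⊖ c ⊕ l)) 1 (λ l → φ-reflection (⊖ c ⊕ l))) (ℕ.*-identityʳ m)
    sum-φ-·-reflections (true  , c) = begin
      sum (tabulate (λ l → φ (false , ⊖ c ⊕ l)))
        ≡⟨ sum-tabulate-const-except (λ l → φ (false , ⊖ c ⊕ l)) c 2 (λ l l≢c → φ-rotation _ (l≢c ∘ ⊖c⊕l≡0⇒l≡c l)) ⟩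
      φ (false , ⊖ c ⊕ c) + suc n * 2              ≡⟨ cong (λ i → φ (false , i) + suc n * 2) (⊕-inverseˡ c) ⟩
      φ e + suc n * 2                              ≡⟨ cong (_+ suc n * 2) φ-e ⟩
      suc n * 2                                    ∎
      where
      open ≡-Reasoning
      ⊖c⊕l≡0⇒l≡c : ∀ l → ⊖ c ⊕ l ≡ Fin.zero → l ≡ c
      ⊖c⊕l≡0⇒l≡c l eq = trans (inverseʳ-unique (⊖ c) l eq) (⁻¹-involutive c)

    lengthSum : I₂ → ℕ → ℕ
    lengthSum = tupleSum _·_ φ T

    lengthSum-suc : ∀ g t → lengthSum g (suc t) ≡ sum (tabulate (λ l → lengthSum (g · (true , l)) t))
    lengthSum-suc g t = trans (tupleSum-suc _·_ φ T g t) (sum-map-T (λ r → lengthSum (g · r) t))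

    lengthSum-closed : ∀ u g → lengthSum g (suc u) ≡ weight (proj₁ g xor isOdd (suc u)) * m ^ u
    lengthSum-closed zero g = begin
      lengthSum g 1                                 ≡⟨ lengthSum-suc g 0 ⟩
      sum (tabulate (λ l → φ (g · (true , l)) + 0)) ≡⟨ cong sum (List.tabulate-cong (λ l → ℕ.+-identityʳ (φ (g · (true , l))))) ⟩
      sum (tabulate (λ l → φ (g · (true , l))))     ≡⟨ sum-φ-·-reflections g ⟩
      weight (proj₁ g xor true)                     ≡⟨ ℕ.*-identityʳ _ ⟨
      weight (proj₁ g xor true) * 1                 ∎
      where open ≡-Reasoning
    lengthSum-closed (suc u) g = begin
      lengthSum g (suc (suc u))
        ≡⟨ lengthSum-suc g (suc u) ⟩
      sum (tabulate (λ l → lengthSum (g · (true , l)) (suc u)))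
        ≡⟨ sum-tabulate-const (λ l → lengthSum (g · (true , l)) (suc u)) (w * m ^ u) lengthSum-g·r ⟩
      m * (w * m ^ u)
        ≡⟨ left-comm m w (m ^ u) ⟩
      w * m ^ suc u ∎
      where
      open ≡-Reasoning
      w : ℕ
      w = weight (proj₁ g xor isOdd (suc (suc u)))
      lengthSum-g·r : ∀ l → lengthSum (g · (true , l)) (suc u) ≡ w * m ^ u
      lengthSum-g·r l = trans (lengthSum-closed u (g · (true , l))) (cong (λ b → weight b * m ^ u) parity)
        where
        parity : proj₁ (g · (true , l)) xor isOdd (suc u) ≡ proj₁ g xor isOdd (suc (suc u))
        parity = trans (cong (_xor isOdd (suc u)) (proj₁-· g (true , l))) (xor-assoc (proj₁ g) true (isOdd (suc u)))
      left-comm : ∀ x y z → x * (y * z) ≡ y * (x * z)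
      left-comm = solve-∀

mainTheorem2 : (n : ℕ) (t : ℕ) → 1 ≤ t → (φ : Dihedral.I₂ n → ℕ) → Dihedral.IsAbsLength n φ →
    (t % 2 ≡ 1 → E (Dihedral._·_ n) (Dihedral.e n) (Dihedral.T n) φ t ≡ 1ℚ)
    × (t % 2 ≡ 0 → E (Dihedral._·_ n) (Dihedral.e n) (Dihedral.T n) φ t ≡ (+ 2 / 1) - (+ 2 / suc (suc n)))
mainTheorem2 n (suc u) _ φ φ-abs = odd , even
  where
  open Dihedral n
  open DihedralFacts n
  open AbsoluteLength φ φ-abs

  E≡divℕ : E _·_ e T φ (suc u) ≡ divℕ (weight (isOdd (suc u)) * m ^ u) (m ^ suc u)
  E≡divℕ = cong₂ divℕ (lengthSum-closed u e) (cong (_^ suc u) length-T)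

  odd : suc u % 2 ≡ 1 → E _·_ e T φ (suc u) ≡ 1ℚ
  odd u-odd = begin
    E _·_ e T φ (suc u)                               ≡⟨ E≡divℕ ⟩
    divℕ (weight (isOdd (suc u)) * m ^ u) (m ^ suc u) ≡⟨ cong (λ b → divℕ (weight b * m ^ u) (m ^ suc u)) (%2≡1⇒isOdd≡true (suc u) u-odd) ⟩
    divℕ (m ^ suc u) (m ^ suc u)                      ≡⟨ divℕ-self (m ^ suc u) (ℕ.m^n>0 m (suc u)) ⟩
    1ℚ                                                ∎
    where open ≡-Reasoning

  even : suc u % 2 ≡ 0 → E _·_ e T φ (suc u) ≡ (+ 2 / 1) - (+ 2 / m)
  even u-even = begin
    E _·_ e T φ (suc u)                               ≡⟨ E≡divℕ ⟩
    divℕ (weight (isOdd (suc u)) * m ^ u) (m ^ suc u) ≡⟨ cong (λ b → divℕ (weight b * m ^ u) (m ^ suc u)) (%2≡0⇒isOdd≡false (suc u) u-even) ⟩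
    divℕ (suc n * 2 * m ^ u) (m * m ^ u)              ≡⟨ divℕ-2[m∸1]P-mP n (m ^ u) (ℕ.m^n>0 m u) ⟩
    (+ 2 / 1) - (+ 2 / m)                             ∎
    where open ≡-Reasoning
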